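{- Let $S\subseteq\mathbb{N}^{\mathbb{N}}$. Then $S$ is guessable if and only if $S$ is $\mathbf{\Delta}^0_2$.
   Context: $\mathbb{N}^{<\mathbb{N}}$ is the set of finite sequences of naturals. A function $G:\mathbb{N}^{<\mathbb{N}}\to\{0,1\}$ guesses $S\subseteq\mathbb{N}^{\mathbb{N}}$ if for every $f:\mathbb{N}\to\mathbb{N}$ there is $m>0$ such that for all $n>m$, $G(f(0),\ldots,f(n))$ equals $1$ if $f\in S$ and $0$ if $f\notin S$; $S$ is guessable if it has a guesser. $\mathbb{N}^{\mathbb{N}}$ carries the topology whose basic open sets are the sets $\{f\in\mathbb{N}^{\mathbb{N}}: f \text{ extends } f_0\}$ for $f_0\in\mathbb{N}^{<\mathbb{N}}$ (the Baire space topology). A set is $G_\delta$ if it is a countable intersection of open sets, $F_\sigma$ if it is a countable union of closed sets, and $\mathbf{\Delta}^0_2$ if it is both $G_\delta$ and $F_\sigma$. -}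

module Defs where

open import Data.Nat using (ℕ; suc; _<_; _>_)
open import Data.Bool using (Bool; true; false)
open import Data.List using (List; map; upTo)
open import Data.Product using (Σ; _×_)
open import Relation.Nullary using (¬_)
open import Relation.Binary.PropositionalEquality using (_≡_)
open import Function.Bundles using (_⇔_)

Baire : Set
Baire = ℕ → ℕ

Subset : Set₁
Subset = Baire → Set

prefix : Baire → ℕ → List ℕ
prefix f n = map f (upTo (suc n))

Guesses : (List ℕ → Bool) → Subset → Set
Guesses G S = (f : Baire) → Σ ℕ λ m → (m > 0) ×
  ((n : ℕ) → n > m → (S f → G (prefix f n) ≡ true) × (¬ S f → G (prefix f n) ≡ false))

Guessable : Subset → Set
Guessable S = Σ (List ℕ → Bool) λ G → Guesses G S

Agree : Baire → Baire → ℕ → Set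
Agree f g n = (i : ℕ) → i < n → f i ≡ g i

IsOpen : Subset → Set
IsOpen U = (f : Baire) → U f → Σ ℕ λ n → (g : Baire) → Agree f g n → U g

IsClosed : Subset → Set
IsClosed C = IsOpen (λ f → ¬ C f)

IsGδ : Subset → Set₁
IsGδ S = Σ (ℕ → Subset) λ U → ((i : ℕ) → IsOpen (U i)) ×
  ((f : Baire) → S f ⇔ ((i : ℕ) → U i f))

IsFσ : Subset → Set₁
IsFσ S = Σ (ℕ → Subset) λ C → ((i : ℕ) → IsClosed (C i)) ×
  ((f : Baire) → S f ⇔ Σ ℕ λ i → C i f)

IsΔ⁰₂ : Subset → Set₁
IsΔ⁰₂ S = IsGδ S × IsFσ S

module Submission where

-- Guessable ⇒ Δ⁰₂.  For any G : ℕ^{<ℕ} → Bool consider the sets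
--   TrueBeyond m     = {f | G says "yes" on every prefix f(0..n), n > m}    (closed)
--   SomeTrueBeyond m = {f | G says "yes" on some prefix f(0..n), n > m}     (open).
-- If G guesses S, then S = ⋃ₘ TrueBeyond m (an F_σ) and S = ⋂ₘ SomeTrueBeyond m
-- (a G_δ): a member is eventually answered "yes", a non-member eventually "no".
--
-- Δ⁰₂ ⇒ guessable.  Write S = ⋂ᵢ Uᵢ with Uᵢ open and S = ⋃ᵢ Cᵢ with Cᵢ closed,
-- and put Vᵢ = ∁Cᵢ (open).  A finite sequence σ *forces* a set P if every
-- sequence extending σ lies in P; a point of an open set has all its long
-- prefixes forcing that set.  The guesser answers "yes" on σ iff for some i,
-- σ forces U₀,…,U_{i-1} but does not force all of V₀,…,V_{i-1}.  If f ∈ Cⱼ ∩ S,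
-- then i = j+1 eventually witnesses this; if f ∉ S, then f lies in every Vₖ but
-- misses some U_{i₀}, and long prefixes of f rule out every i (i ≤ i₀ fails the
-- V-condition, i > i₀ the U-condition).
--
-- Excluded middle enters only to decide membership and to pass from ¬∀ to ∃¬.

open import Defs
open import Level using (0ℓ)
open import Axiom.ExcludedMiddle using (ExcludedMiddle)
open import Axiom.DoubleNegationElimination using (DoubleNegationElimination; em⇒dne)
open import Function using (_∘_)
open import Function.Bundles using (_⇔_; mk⇔; module Equivalence)
open import Data.Nat using (ℕ; zero; suc; _<_; _>_; _≤_; _⊔_; _≤?_; z≤n; s≤s)
open import Data.Nat.Properties
  using (≤-refl; ≤-trans; <⇒≤; <-≤-trans; n≤1+n; m≤m⊔n; m≤n⊔m; ≰⇒>; m<n⇒m<1+n; m<1+n⇒m<n∨m≡n)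
open import Data.Bool using (Bool; true; false)
open import Data.List using (List; applyUpTo)
open import Data.List.Properties using (∷-injective; map-upTo; map-cong-local)
open import Data.List.Relation.Unary.All as All using ()
open import Data.List.Membership.Propositional.Properties using (∈-upTo⁻)
open import Data.Product using (Σ; _×_; _,_; proj₁; proj₂)
open import Data.Sum using (inj₁; inj₂)
open import Data.Empty using (⊥-elim)
open import Relation.Nullary using (¬_; yes; no; does)
open import Relation.Nullary.Decidable using (dec-true; dec-false)
open import Relation.Binary.PropositionalEquality using (_≡_; refl; sym; trans; cong; module ≡-Reasoning)

open Equivalence using (to; from)

applyUpTo-agree : (f g : ℕ → ℕ) {m n i : ℕ} →
  applyUpTo f m ≡ applyUpTo g n → i < m → f i ≡ g i
applyUpTo-agree f g {suc m} {zero}  ()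
applyUpTo-agree f g {suc m} {suc n} {zero}  eq _ = proj₁ (∷-injective eq)
applyUpTo-agree f g {suc m} {suc n} {suc i} eq (s≤s i<m) =
  applyUpTo-agree (f ∘ suc) (g ∘ suc) (proj₂ (∷-injective eq)) i<m

prefix-agree : {f g : Baire} {n n′ i : ℕ} → prefix f n ≡ prefix g n′ → i ≤ n → f i ≡ g i
prefix-agree {f} {g} {n} {n′} eq i≤n = applyUpTo-agree f g lists (s≤s i≤n)
  where
  open ≡-Reasoning
  lists : applyUpTo f (suc n) ≡ applyUpTo g (suc n′)
  lists = begin
    applyUpTo f (suc n)  ≡⟨ sym (map-upTo f (suc n)) ⟩
    prefix f n           ≡⟨ eq ⟩
    prefix g n′          ≡⟨ map-upTo g (suc n′) ⟩
    applyUpTo g (suc n′) ∎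

prefix-cong : {f g : Baire} {n : ℕ} → Agree f g (suc n) → prefix f n ≡ prefix g n
prefix-cong agree = map-cong-local (All.tabulate λ i∈ → agree _ (∈-upTo⁻ i∈))

Eventually : (ℕ → Set) → Set
Eventually P = Σ ℕ λ M → (n : ℕ) → M ≤ n → P n

eventually-map : {P Q : ℕ → Set} → ((n : ℕ) → P n → Q n) → Eventually P → Eventually Q
eventually-map P⇒Q (M , p) = M , λ n M≤n → P⇒Q n (p n M≤n)

eventually-both : {P Q : ℕ → Set} → Eventually P → Eventually Q → Eventually (λ n → P n × Q n)
eventually-both (M₁ , p) (M₂ , q) =
  M₁ ⊔ M₂ , λ n le → p n (≤-trans (m≤m⊔n M₁ M₂) le) , q n (≤-trans (m≤n⊔m M₁ M₂) le)

eventually-all : (P : ℕ → ℕ → Set) (N : ℕ) →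
  ((k : ℕ) → k < N → Eventually (P k)) → Eventually (λ n → (k : ℕ) → k < N → P k n)
eventually-all P zero    _  = 0 , λ _ _ _ ()
eventually-all P (suc N) ev =
  eventually-map split (eventually-both below (ev N ≤-refl))
  where
  below : Eventually (λ n → (k : ℕ) → k < N → P k n)
  below = eventually-all P N λ k k<N → ev k (m<n⇒m<1+n k<N)
  split : (n : ℕ) → ((k : ℕ) → k < N → P k n) × P N n → (k : ℕ) → k < suc N → P k n
  split n (ps , pN) k k<1+N with m<1+n⇒m<n∨m≡n k<1+N
  ... | inj₁ k<N  = ps k k<N
  ... | inj₂ refl = pN

eventually⇒window : {P : ℕ → Set} → Eventually P → Σ ℕ λ m → (m > 0) × ((n : ℕ) → n > m → P n)
eventually⇒window (M , p) = suc M , s≤s z≤n , λ n n>1+M → p n (≤-trans (n≤1+n M) (<⇒≤ n>1+M))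

¬∀⇒∃¬ : DoubleNegationElimination 0ℓ → {P : ℕ → Set} → ¬ ((i : ℕ) → P i) → Σ ℕ λ i → ¬ P i
¬∀⇒∃¬ dne ¬all = dne λ none → ¬all λ i → dne λ ¬p → none (i , ¬p)

module Approximations (G : List ℕ → Bool) where

  TrueBeyond : ℕ → Subset
  TrueBeyond m f = (n : ℕ) → n > m → G (prefix f n) ≡ true

  SomeTrueBeyond : ℕ → Subset
  SomeTrueBeyond m f = Σ ℕ λ n → (n > m) × (G (prefix f n) ≡ true)

  someTrueBeyond-open : (m : ℕ) → IsOpen (SomeTrueBeyond m)
  someTrueBeyond-open m f (n , n>m , yes-n) =
    suc n , λ g agree → n , n>m , trans (cong G (sym (prefix-cong agree))) yes-n

  refuted-beyond : DoubleNegationElimination 0ℓ → {m : ℕ} {f : Baire} →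
    ¬ TrueBeyond m f → Σ ℕ λ n → (n > m) × ¬ (G (prefix f n) ≡ true)
  refuted-beyond dne ¬always = dne λ none → ¬always λ n n>m → dne λ ¬yes → none (n , n>m , ¬yes)

  -- All sequences sharing that prefix stay outside TrueBeyond m.
  trueBeyond-closed : DoubleNegationElimination 0ℓ → (m : ℕ) → IsClosed (TrueBeyond m)
  trueBeyond-closed dne m f ¬always with refuted-beyond dne ¬always
  ... | n , n>m , ¬yes-n = suc n , λ g agree always-g →
    ¬yes-n (trans (cong G (prefix-cong agree)) (always-g n n>m))

  trueBeyond⇒someTrueBeyond : {m : ℕ} {f : Baire} → TrueBeyond m f → (m′ : ℕ) → SomeTrueBeyond m′ f
  trueBeyond⇒someTrueBeyond {m} always m′ =
    suc (m ⊔ m′) , s≤s (m≤n⊔m m m′) , always (suc (m ⊔ m′)) (s≤s (m≤m⊔n m m′))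

  module _ {S : Subset} (guesses : Guesses G S) where

    member⇒trueBeyond : {f : Baire} → S f → Σ ℕ λ m → TrueBeyond m f
    member⇒trueBeyond {f} s with guesses f
    ... | m , _ , window = m , λ n n>m → proj₁ (window n n>m) s

    -- Infinitely many "yes" answers exclude that G settles on "no".
    someTrueBeyond⇒member : DoubleNegationElimination 0ℓ → {f : Baire} →
      ((m : ℕ) → SomeTrueBeyond m f) → S f
    someTrueBeyond⇒member dne {f} often = dne λ ¬s →
      let (m , _ , window)  = guesses f
          (n , n>m , yes-n) = often m
      in true≢false (trans (sym yes-n) (proj₂ (window n n>m) ¬s))
      where
      true≢false : ¬ (true ≡ false)
      true≢false ()

guessable⇒Δ⁰₂ : DoubleNegationElimination 0ℓ → {S : Subset} → Guessable S → IsΔ⁰₂ S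
guessable⇒Δ⁰₂ dne (G , guesses) =
  ( SomeTrueBeyond , someTrueBeyond-open
  , λ f → mk⇔ (λ s → trueBeyond⇒someTrueBeyond (proj₂ (member⇒trueBeyond guesses s)))
              (someTrueBeyond⇒member guesses dne) )
  , ( TrueBeyond , trueBeyond-closed dne
    , λ f → mk⇔ (member⇒trueBeyond guesses)
                (λ (m , always) → someTrueBeyond⇒member guesses dne (trueBeyond⇒someTrueBeyond always)) )
  where open Approximations G

Forces : List ℕ → Subset → Set
Forces σ P = (g : Baire) (n : ℕ) → prefix g n ≡ σ → P g

open-forced : {W : Subset} → IsOpen W → {f : Baire} → W f → Eventually (λ n → Forces (prefix f n) W)
open-forced W-open {f} w with W-open f w
... | k , nbhd = k , λ n k≤n g n′ same →
  nbhd g λ i i<k → prefix-agree (sym same) (<⇒≤ (<-≤-trans i<k k≤n))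

module Guesser (em : ExcludedMiddle 0ℓ) (S : Subset)
  (U : ℕ → Subset) (U-open : (i : ℕ) → IsOpen (U i)) (S⇔⋂U : (f : Baire) → S f ⇔ ((i : ℕ) → U i f))
  (C : ℕ → Subset) (C-closed : (i : ℕ) → IsClosed (C i)) (S⇔⋃C : (f : Baire) → S f ⇔ Σ ℕ λ i → C i f)
  where

  V : ℕ → Subset
  V i f = ¬ C i f

  Witness : List ℕ → Set
  Witness σ = Σ ℕ λ i → ((k : ℕ) → k < i → Forces σ (U k)) × ¬ ((k : ℕ) → k < i → Forces σ (V k))

  guess : List ℕ → Bool
  guess σ = does (em {Witness σ})

  -- For f ∈ Cⱼ ∩ S, long prefixes of f have the witness i = j + 1.
  member-eventually-true : {f : Baire} → S f → Eventually (λ n → guess (prefix f n) ≡ true)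
  member-eventually-true {f} s with to (S⇔⋃C f) s
  ... | j , c-j = eventually-map guess-yes forcedU
    where
    -- f lies in every Uₖ, so its long prefixes force U₀, …, U_j ...
    forcedU : Eventually (λ n → (k : ℕ) → k < suc j → Forces (prefix f n) (U k))
    forcedU = eventually-all (λ k n → Forces (prefix f n) (U k)) (suc j)
                λ k _ → open-forced (U-open k) (to (S⇔⋂U f) s k)
    -- ... while no prefix of f forces V_j, as f itself lies in C_j.
    guess-yes : (n : ℕ) → ((k : ℕ) → k < suc j → Forces (prefix f n) (U k)) → guess (prefix f n) ≡ true
    guess-yes n forced = dec-true em (suc j , forced , λ forcedV → forcedV j ≤-refl f n refl c-j)

  no-witness : {f : Baire} {n i₀ : ℕ} → ¬ U i₀ f →
    ((k : ℕ) → k < i₀ → Forces (prefix f n) (V k)) → ¬ Witness (prefix f n)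
  no-witness {f} {n} {i₀} ¬u forcedV (i , forcedU , ¬forcedV) with i ≤? i₀
  ... | yes i≤i₀ = ¬forcedV λ k k<i → forcedV k (<-≤-trans k<i i≤i₀)
  ... | no  i≰i₀ = ¬u (forcedU i₀ (≰⇒> i≰i₀) f n refl)

  -- For f ∉ S, pick U_{i₀} missing f; long prefixes then have no witness.
  nonmember-eventually-false : {f : Baire} → ¬ S f → Eventually (λ n → guess (prefix f n) ≡ false)
  nonmember-eventually-false {f} ¬s with ¬∀⇒∃¬ (em⇒dne em) (λ inAll → ¬s (from (S⇔⋂U f) inAll))
  ... | i₀ , ¬u = eventually-map (λ n forced → dec-false em (no-witness ¬u forced)) forcedV
    where
    -- f lies in no Cₖ, so its long prefixes force V₀, …, V_{i₀-1}.
    forcedV : Eventually (λ n → (k : ℕ) → k < i₀ → Forces (prefix f n) (V k))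
    forcedV = eventually-all (λ k n → Forces (prefix f n) (V k)) i₀
                λ k _ → open-forced (C-closed k) λ c → ¬s (from (S⇔⋃C f) (k , c))

  guess-correct : Guesses guess S
  guess-correct f with em {S f}
  ... | yes s  = eventually⇒window
    (eventually-map (λ _ yes-n → (λ _ → yes-n) , λ ¬s → ⊥-elim (¬s s)) (member-eventually-true s))
  ... | no  ¬s = eventually⇒window
    (eventually-map (λ _ no-n → (λ s → ⊥-elim (¬s s)) , λ _ → no-n) (nonmember-eventually-false ¬s))

Δ⁰₂⇒guessable : ExcludedMiddle 0ℓ → {S : Subset} → IsΔ⁰₂ S → Guessable S
Δ⁰₂⇒guessable em {S} ((U , U-open , S⇔⋂U) , (C , C-closed , S⇔⋃C)) =
  guess , guess-correct
  where open Guesser em S U U-open S⇔⋂U C C-closed S⇔⋃C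

theorem16 : ExcludedMiddle 0ℓ → (S : Subset) → Guessable S ⇔ IsΔ⁰₂ S
theorem16 em S = mk⇔ (guessable⇒Δ⁰₂ (em⇒dne em)) (Δ⁰₂⇒guessable em)
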